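{- For every Helly graph $G$, if $\tau(G)$ is even, then $hb(G)$ is an integer and $2hb(G)=\tau(G)$.
   Context: Graphs are finite, connected, unweighted, undirected and simple; $d$ is the shortest-path distance. A graph is Helly if every family of pairwise intersecting disks $D(v,r)=\{u:d(u,v)\le r\}$ has a common vertex. $hb(G)$ is the maximum over quadruples $u,v,w,x$ of one half of the difference between the two largest of $d(u,v)+d(w,x)$, $d(u,w)+d(v,x)$, $d(u,x)+d(v,w)$. $I(x,y)=\{z: d(x,z)+d(z,y)=d(x,y)\}$, $S_j(x,y)=\{z\in I(x,y): d(x,z)=j\}$, and $\tau(G)=\max\{d(u,v): u,v\in S_j(x,y),\ x,y\in V(G),\ j\in\mathbb{N}\}$. -}

module Defs where

open import Data.Nat using (ℕ; zero; suc; _+_; _∸_; _≤_; _⊔_; _⊓_; _≟_)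
open import Data.Fin using (Fin)
open import Data.List using (List; []; _∷_; map; foldr; concatMap; allFin)
open import Data.List.Membership.Propositional using (_∈_)
open import Data.Product using (Σ; ∃; _×_; _,_)
open import Data.Bool using (Bool; true; false; if_then_else_; _∧_)
open import Relation.Nullary using (¬_)
open import Relation.Nullary.Decidable using (⌊_⌋)
open import Relation.Binary.PropositionalEquality using (_≡_)

record Graph (n : ℕ) : Set₁ where
  field
    Adj     : Fin n → Fin n → Set
    irrefl  : ∀ u → ¬ Adj u u
    sym     : ∀ {u v} → Adj u v → Adj v u
open Graph public

data Walk {n : ℕ} (G : Graph n) : Fin n → Fin n → ℕ → Set where
  here : ∀ {u} → Walk G u u zero
  step : ∀ {u v w k} → Adj G u v → Walk G v w k → Walk G u w (suc k)

Connected : ∀ {n} → Graph n → Set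
Connected {n} G = ∀ (u v : Fin n) → ∃ λ k → Walk G u v k

IsDistance : ∀ {n} → Graph n → (Fin n → Fin n → ℕ) → Set
IsDistance {n} G d =
  ∀ (u v : Fin n) → Walk G u v (d u v) × (∀ k → Walk G u v k → d u v ≤ k)

-- Disk D(v,r), given as a (center , radius) pair.
InDisk : ∀ {n} → (Fin n → Fin n → ℕ) → Fin n → Fin n × ℕ → Set
InDisk d z (c , r) = d c z ≤ r

Helly : ∀ {n} → (Fin n → Fin n → ℕ) → Set
Helly {n} d =
  ∀ (F : List (Fin n × ℕ)) →
    (∀ {D D'} → D ∈ F → D' ∈ F → ∃ λ z → InDisk d z D × InDisk d z D') →
    ∃ λ (z : Fin n) → ∀ {D} → D ∈ F → InDisk d z D

maxL : List ℕ → ℕ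
maxL = foldr _⊔_ 0

quads : ∀ n → List (Fin n × Fin n × Fin n × Fin n)
quads n = concatMap (λ a → concatMap (λ b → concatMap (λ c → map (λ e → a , b , c , e)
            (allFin n)) (allFin n)) (allFin n)) (allFin n)

-- difference between the largest and the second largest of three numbers
max3 : ℕ → ℕ → ℕ → ℕ
max3 a b c = a ⊔ b ⊔ c

median3 : ℕ → ℕ → ℕ → ℕ
median3 a b c = (a ⊓ b) ⊔ (b ⊓ c) ⊔ (a ⊓ c)

gap : ℕ → ℕ → ℕ → ℕ
gap a b c = max3 a b c ∸ median3 a b c

-- twice the hyperbolicity: 2·hb(G) = max over quadruples of the gap
hb2 : ∀ {n} → (Fin n → Fin n → ℕ) → ℕ
hb2 {n} d = maxL (map (λ { (u , v , w , x) →
  gap (d u v + d w x) (d u w + d v x) (d u x + d v w) }) (quads n))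

inIntervalᵇ : ∀ {n} → (Fin n → Fin n → ℕ) → Fin n → Fin n → Fin n → Bool
inIntervalᵇ d x y z = ⌊ d x z + d z y ≟ d x y ⌋

-- τ(G): max of d(u,v) over u,v ∈ S_j(x,y), i.e. u,v ∈ I(x,y) with d(x,u) = d(x,v) (= j)
tau : ∀ {n} → (Fin n → Fin n → ℕ) → ℕ
tau {n} d = maxL (map (λ { (x , y , u , v) →
  if inIntervalᵇ d x y u ∧ inIntervalᵇ d x y v ∧ ⌊ d x u ≟ d x v ⌋
  then d u v else 0 }) (quads n))

-- 2·hb ≥ τ in every graph: if u and v lie in a common slice S_j(x,y), the three
-- pair sums of x, y, u, v are d(x,y) + d(u,v), d(x,y) and d(x,y).
-- Conversely, let d(u,x) + d(v,w) ≤ d(u,w) + d(v,x) and pick i with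
-- 2i ≈ d(u,x) + d(u,v) − d(v,x). The disks D(u,i), D(v,d(u,v) − i), D(w,d(u,w) − i)
-- pairwise meet, so by the Helly property some vertex a of the slice S_i(u,v) is
-- within d(u,w) − i of w; likewise some b ∈ S_i(u,v) is within d(v,x) − d(u,v) + i
-- of x. As d(a,b) ≤ τ, the triangle inequality through a and b gives
-- d(u,v) + d(w,x) ≤ d(u,w) + d(v,x) + τ. Rounding i may cost 1; when it does both
-- for the pair (u,v) and for the pair (w,x), the two sides have the same parity and
-- the evenness of τ absorbs the loss.
module Submission where

open import Defs hiding (sym)
open import Data.Nat using (ℕ; zero; suc; _+_; _*_; _∸_; _≤_; _⊔_; _⊓_; _≟_; z≤n)
open import Data.Nat.Properties
open import Data.Nat.Divisibility using (_∣_; divides)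
open import Algebra.Properties.CommutativeSemigroup +-commutativeSemigroup
  using () renaming (interchange to +-interchange)
open import Data.Nat.Tactic.RingSolver using (solve-∀; solve)
open import Data.Fin using (Fin)
open import Data.Product using (_×_; _,_; ∃; proj₁; proj₂)
open import Data.Sum using (_⊎_; inj₁; inj₂)
open import Data.List using (List; []; _∷_; map)
open import Function using (_∘_)
open import Data.List.Relation.Unary.Any using (here; there)
open import Data.List.Membership.Propositional using (_∈_; lose)
open import Data.List.Membership.Propositional.Properties using (∈-map⁺; ∈-concatMap⁺; ∈-allFin)
open import Relation.Nullary using (yes; no; contradiction)
open import Relation.Nullary.Decidable using (⌊_⌋)
open import Data.Bool using (if_then_else_; _∧_)
open import Relation.Binary.PropositionalEquality
  using (_≡_; _≢_; refl; sym; trans; cong; cong₂; subst; subst₂; module ≡-Reasoning)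

maxL-map-≤ : ∀ {A : Set} (f : A → ℕ) (xs : List A) {t} → (∀ a → f a ≤ t) → maxL (map f xs) ≤ t
maxL-map-≤ f []       f≤t = z≤n
maxL-map-≤ f (a ∷ xs) f≤t = ⊔-lub (f≤t a) (maxL-map-≤ f xs f≤t)

≤-maxL-map : ∀ {A : Set} (f : A → ℕ) {xs : List A} {a} → a ∈ xs → f a ≤ maxL (map f xs)
≤-maxL-map f (here refl) = m≤m⊔n _ _
≤-maxL-map f (there a∈xs) = ≤-trans (≤-maxL-map f a∈xs) (m≤n⊔m _ _)

maxL-map-mono : ∀ {A : Set} (f g : A → ℕ) (xs : List A) → (∀ a → f a ≤ g a) →
  maxL (map f xs) ≤ maxL (map g xs)
maxL-map-mono f g []       f≤g = z≤n
maxL-map-mono f g (a ∷ xs) f≤g = ⊔-mono-≤ (f≤g a) (maxL-map-mono f g xs f≤g)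

∈-quads : ∀ {n} (a b c e : Fin n) → (a , b , c , e) ∈ quads n
∈-quads a b c e =
  ∈-concatMap⁺ _ (lose (∈-allFin a) (∈-concatMap⁺ _ (lose (∈-allFin b)
    (∈-concatMap⁺ _ (lose (∈-allFin c) (∈-map⁺ _ (∈-allFin e)))))))

m≤n+t⇒m≤m⊓n+t : ∀ {x y t} → x ≤ y + t → x ≤ x ⊓ y + t
m≤n+t⇒m≤m⊓n+t {x} {y} {t} x≤y+t with ≤-total x y
... | inj₁ x≤y rewrite m≤n⇒m⊓n≡m x≤y = m≤m+n x t
... | inj₂ y≤x rewrite m≥n⇒m⊓n≡n y≤x = x≤y+t

m≤n⊔o+t⇒m≤m⊓n⊔m⊓o+t : ∀ {x y z t} → x ≤ y ⊔ z + t → x ≤ (x ⊓ y) ⊔ (x ⊓ z) + t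
m≤n⊔o+t⇒m≤m⊓n⊔m⊓o+t {x} {y} {z} {t} h =
  subst (λ m → x ≤ m + t) (⊓-distribˡ-⊔ x y z) (m≤n+t⇒m≤m⊓n+t h)

module _ (a b c : ℕ) where

  ⊓-≤-median₁₂ : a ⊓ b ≤ median3 a b c
  ⊓-≤-median₁₂ = ≤-trans (m≤m⊔n _ (b ⊓ c)) (m≤m⊔n _ (a ⊓ c))

  ⊓-≤-median₂₃ : b ⊓ c ≤ median3 a b c
  ⊓-≤-median₂₃ = ≤-trans (m≤n⊔m (a ⊓ b) _) (m≤m⊔n _ (a ⊓ c))

  ⊓-≤-median₁₃ : a ⊓ c ≤ median3 a b c
  ⊓-≤-median₁₃ = m≤n⊔m _ _

gap-≤ : ∀ {a b c t} → a ≤ b ⊔ c + t → b ≤ a ⊔ c + t → c ≤ a ⊔ b + t → gap a b c ≤ t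
gap-≤ {a} {b} {c} {t} ha hb hc = m≤n+o⇒m∸n≤o (max3 a b c) (median3 a b c) (⊔-lub (⊔-lub
  (≤median+t ha (⊓-≤-median₁₂ a b c) (⊓-≤-median₁₃ a b c))
  (≤median+t hb (swap (⊓-≤-median₁₂ a b c)) (⊓-≤-median₂₃ a b c)))
  (≤median+t hc (swap (⊓-≤-median₁₃ a b c)) (swap (⊓-≤-median₂₃ a b c))))
  where
  swap : ∀ {x y} → x ⊓ y ≤ median3 a b c → y ⊓ x ≤ median3 a b c
  swap {x} {y} = subst (_≤ median3 a b c) (⊓-comm x y)
  ≤median+t : ∀ {x y z} → x ≤ y ⊔ z + t → x ⊓ y ≤ median3 a b c → x ⊓ z ≤ median3 a b c →
              x ≤ median3 a b c + t
  ≤median+t h xy xz = ≤-trans (m≤n⊔o+t⇒m≤m⊓n⊔m⊓o+t h) (+-monoˡ-≤ t (⊔-lub xy xz))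

gap-+ : ∀ m q → gap (m + q) m m ≡ q
gap-+ m q rewrite m≥n⇒m⊓n≡n (m≤m+n m q) | ⊓-idem m | ⊔-idem m | ⊔-idem m
        | m≥n⇒m⊔n≡m (m≤m+n m q) | m≥n⇒m⊔n≡m (m≤m+n m q)
  = m+n∸m≡n m q

2*m≡m+m : ∀ m → 2 * m ≡ m + m
2*m≡m+m m = cong (m +_) (+-identityʳ m)

even-or-odd : ∀ p → ∃ λ i → 2 * i ≡ p ⊎ 2 * i ≡ suc p
even-or-odd zero = zero , inj₁ refl
even-or-odd (suc p) with even-or-odd p
... | i , inj₁ 2i≡p  = suc i , inj₂ (trans (*-suc 2 i) (cong (suc ∘ suc) 2i≡p))
... | i , inj₂ 2i≡1+p = i , inj₁ 2i≡1+p

2*i≤2*m+e⇒i≤m : ∀ {i m e} → e ≤ 1 → 2 * i ≤ 2 * m + e → i ≤ m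
2*i≤2*m+e⇒i≤m {i} {m} {e} e≤1 2i≤ = ≤-pred (*-cancelˡ-< 2 i (suc m) (begin-strict
  2 * i           ≤⟨ 2i≤ ⟩
  2 * m + e       ≤⟨ +-monoʳ-≤ (2 * m) e≤1 ⟩
  2 * m + 1       <⟨ n<1+n _ ⟩
  suc (2 * m + 1) ≡⟨ solve (m ∷ []) ⟩
  2 * suc m       ∎))
  where open ≤-Reasoning

-- Radii for which the disks D(u,i), D(v,j), D(w,r), D(x,s) pairwise meet, with
-- uv, uw, ... standing for the distances d u v, d u w, ...
record SliceRadii (uv uw ux vw vx i e : ℕ) : Set where
  field
    j r s   : ℕ
    uv≡i+j  : uv ≡ i + j
    uw≤i+r  : uw ≤ i + r
    vw≤j+r  : vw ≤ j + r
    ux≤i+s  : ux ≤ i + s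
    vx≤j+s  : vx ≤ j + s
    total   : uv + (r + s) ≡ e + (uw + vx)

slice-radii : ∀ uv uw ux vw vx i e → e ≤ 1 →
  uw ≤ uv + vw → uv ≤ uw + vw → uv ≤ ux + vx →
  ux + uv ≤ 2 * i + vx → 2 * i + vw ≤ e + (uw + uv) →
  SliceRadii uv uw ux vw vx i e
slice-radii uv uw ux vw vx i e e≤1 uw≤uv+vw uv≤uw+vw uv≤ux+vx E₁ E₂ =
  record
    { j = j ; r = r ; s = s ; uv≡i+j = sym i+j≡uv ; uw≤i+r = uw≤i+r ; vw≤j+r = vw≤j+r
    ; ux≤i+s = ux≤i+s ; vx≤j+s = ≤-reflexive (sym j+s≡vx) ; total = total }
  where
  open ≤-Reasoning
  i≤uv : i ≤ uv
  i≤uv = 2*i≤2*m+e⇒i≤m e≤1 (+-cancelʳ-≤ vw (2 * i) (2 * uv + e) (begin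
    2 * i + vw          ≤⟨ E₂ ⟩
    e + (uw + uv)       ≤⟨ +-monoʳ-≤ e (+-monoˡ-≤ uv uw≤uv+vw) ⟩
    e + (uv + vw + uv)  ≡⟨ solve (uv ∷ vw ∷ e ∷ []) ⟩
    2 * uv + e + vw     ∎))
  i≤uw : i ≤ uw
  i≤uw = 2*i≤2*m+e⇒i≤m e≤1 (+-cancelʳ-≤ vw (2 * i) (2 * uw + e) (begin
    2 * i + vw           ≤⟨ E₂ ⟩
    e + (uw + uv)        ≤⟨ +-monoʳ-≤ e (+-monoʳ-≤ uw uv≤uw+vw) ⟩
    e + (uw + (uw + vw)) ≡⟨ solve (uw ∷ vw ∷ e ∷ []) ⟩
    2 * uw + e + vw      ∎))
  uv≤i+vx : uv ≤ i + vx
  uv≤i+vx = *-cancelˡ-≤ 2 (begin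
    2 * uv          ≡⟨ solve (uv ∷ []) ⟩
    uv + uv         ≤⟨ +-monoˡ-≤ uv uv≤ux+vx ⟩
    ux + vx + uv    ≡⟨ solve (ux ∷ vx ∷ uv ∷ []) ⟩
    ux + uv + vx    ≤⟨ +-monoˡ-≤ vx E₁ ⟩
    2 * i + vx + vx ≡⟨ solve (i ∷ vx ∷ []) ⟩
    2 * (i + vx)    ∎)
  j r s : ℕ
  j = uv ∸ i
  r = e + uw ∸ i
  s = vx ∸ j
  i+j≡uv : i + j ≡ uv
  i+j≡uv = m+[n∸m]≡n i≤uv
  i+r≡e+uw : i + r ≡ e + uw
  i+r≡e+uw = m+[n∸m]≡n (≤-trans i≤uw (m≤n+m uw e))
  j+s≡vx : j + s ≡ vx
  j+s≡vx = m+[n∸m]≡n (+-cancelˡ-≤ i j vx (subst (_≤ i + vx) (sym i+j≡uv) uv≤i+vx))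
  uw≤i+r : uw ≤ i + r
  uw≤i+r = subst (uw ≤_) (sym i+r≡e+uw) (m≤n+m uw e)
  vw≤j+r : vw ≤ j + r
  vw≤j+r = +-cancelˡ-≤ (2 * i) vw (j + r) (begin
    2 * i + vw          ≤⟨ E₂ ⟩
    e + (uw + uv)       ≡⟨ solve (e ∷ uw ∷ uv ∷ []) ⟩
    e + uw + uv         ≡⟨ cong₂ _+_ (sym i+r≡e+uw) (sym i+j≡uv) ⟩
    i + r + (i + j)     ≡⟨ +-interchange i r i j ⟩
    i + i + (r + j)     ≡⟨ cong₂ _+_ (sym (2*m≡m+m i)) (+-comm r j) ⟩
    2 * i + (j + r)     ∎)
  ux≤i+s : ux ≤ i + s
  ux≤i+s = +-cancelʳ-≤ uv ux (i + s) (begin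
    ux + uv             ≤⟨ E₁ ⟩
    2 * i + vx          ≡⟨ cong (2 * i +_) (sym j+s≡vx) ⟩
    2 * i + (j + s)     ≡⟨ cong (_+ (j + s)) (2*m≡m+m i) ⟩
    i + i + (j + s)     ≡⟨ +-interchange i i j s ⟩
    i + j + (i + s)     ≡⟨ cong (_+ (i + s)) i+j≡uv ⟩
    uv + (i + s)        ≡⟨ +-comm uv (i + s) ⟩
    i + s + uv          ∎)
  total : uv + (r + s) ≡ e + (uw + vx)
  total = begin-equality
    uv + (r + s)        ≡⟨ cong (_+ (r + s)) (sym i+j≡uv) ⟩
    i + j + (r + s)     ≡⟨ +-interchange i j r s ⟩
    i + r + (j + s)     ≡⟨ cong₂ _+_ i+r≡e+uw j+s≡vx ⟩
    e + uw + vx         ≡⟨ +-assoc e uw vx ⟩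
    e + (uw + vx)       ∎

excess-≤ : ∀ k p ux uv uw vw vx → vx + p ≡ ux + uv → k + ux + vw ≤ uw + vx →
           k + p + vw ≤ uw + uv
excess-≤ k p ux uv uw vw vx vx+p≡ux+uv k+ux+vw≤ = +-cancelʳ-≤ vx _ _ (begin
  k + p + vw + vx     ≡⟨ solve (k ∷ p ∷ vw ∷ vx ∷ []) ⟩
  k + vw + (vx + p)   ≡⟨ cong (k + vw +_) vx+p≡ux+uv ⟩
  k + vw + (ux + uv)  ≡⟨ solve (k ∷ vw ∷ ux ∷ uv ∷ []) ⟩
  k + ux + vw + uv    ≤⟨ +-monoˡ-≤ uv k+ux+vw≤ ⟩
  uw + vx + uv        ≡⟨ solve (uw ∷ vx ∷ uv ∷ []) ⟩
  uw + uv + vx        ∎)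
  where open ≤-Reasoning

odd-slice : ∀ i ux uv uw vw vx → ux + vw ≡ uw + vx → suc (ux + uv) ≡ 2 * i + vx →
            2 * i + vw ≡ suc (uw + uv)
odd-slice i ux uv uw vw vx balanced odd = +-cancelʳ-≡ vx _ _ (begin
  2 * i + vw + vx     ≡⟨ solve (i ∷ vw ∷ vx ∷ []) ⟩
  2 * i + vx + vw     ≡⟨ cong (_+ vw) (sym odd) ⟩
  suc (ux + uv) + vw  ≡⟨ solve (ux ∷ uv ∷ vw ∷ []) ⟩
  suc (ux + vw + uv)  ≡⟨ cong (λ m → suc (m + uv)) balanced ⟩
  suc (uw + vx + uv)  ≡⟨ solve (uw ∷ vx ∷ uv ∷ []) ⟩
  suc (uw + uv) + vx  ∎)
  where open ≡-Reasoning

parity-clash : ∀ i i′ k ux uv uw vw vx wx → ux + vw ≡ uw + vx →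
  suc (ux + uv) ≡ 2 * i + vx → suc (vw + wx) ≡ 2 * i′ + vx →
  uv + wx ≢ suc (uw + vx + 2 * k)
parity-clash i i′ k ux uv uw vw vx wx balanced odd odd′ tight =
  even≢odd (i + i′ + vx) (1 + uw + vx + k) (begin
    2 * (i + i′ + vx)                   ≡⟨ solve (i ∷ i′ ∷ vx ∷ []) ⟩
    (2 * i + vx) + (2 * i′ + vx)        ≡⟨ cong₂ _+_ (sym odd) (sym odd′) ⟩
    suc (ux + uv) + suc (vw + wx)       ≡⟨ solve (ux ∷ uv ∷ vw ∷ wx ∷ []) ⟩
    2 + (ux + vw) + (uv + wx)           ≡⟨ cong₂ (λ m m′ → 2 + m + m′) balanced tight ⟩
    2 + (uw + vx) + suc (uw + vx + 2 * k) ≡⟨ solve (uw ∷ vx ∷ k ∷ []) ⟩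
    suc (2 * (1 + uw + vx + k))         ∎)
  where open ≡-Reasoning

module _ {n : ℕ} (d : Fin n → Fin n → ℕ) where

  sliceDistance : Fin n → Fin n → Fin n → Fin n → ℕ
  sliceDistance x y u v =
    if inIntervalᵇ d x y u ∧ inIntervalᵇ d x y v ∧ ⌊ d x u ≟ d x v ⌋ then d u v else 0

  same-slice⇒≤tau : ∀ {x y u v} → d x u + d u y ≡ d x y → d x v + d v y ≡ d x y →
                    d x u ≡ d x v → d u v ≤ tau d
  same-slice⇒≤tau {x} {y} {u} {v} u∈I v∈I same = subst (_≤ tau d) term≡
    (≤-maxL-map (λ { (x , y , u , v) → sliceDistance x y u v }) (∈-quads x y u v))
    where
    term≡ : sliceDistance x y u v ≡ d u v
    term≡ with d x u + d u y ≟ d x y | d x v + d v y ≟ d x y | d x u ≟ d x v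
    ... | yes _ | yes _ | yes _ = refl
    ... | no ¬p | _     | _     = contradiction u∈I ¬p
    ... | yes _ | no ¬p | _     = contradiction v∈I ¬p
    ... | yes _ | yes _ | no ¬p = contradiction same ¬p

  module _ (d-sym : ∀ u v → d u v ≡ d v u) where

    tau≤hb2 : tau d ≤ hb2 d
    tau≤hb2 = maxL-map-mono _ _ (quads n) λ { (x , y , u , v) → sliceDistance≤gap x y u v }
      where
      sliceDistance≤gap : ∀ x y u v →
        sliceDistance x y u v ≤ gap (d x y + d u v) (d x u + d y v) (d x v + d y u)
      sliceDistance≤gap x y u v
        with d x u + d u y ≟ d x y | d x v + d v y ≟ d x y | d x u ≟ d x v
      ... | yes u∈I | yes v∈I | yes same = ≤-reflexive (sym (begin
            gap (d x y + d u v) (d x u + d y v) (d x v + d y u)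
              ≡⟨ cong₂ (gap (d x y + d u v)) xu+yv xv+yu ⟩
            gap (d x y + d u v) (d x y) (d x y)
              ≡⟨ gap-+ (d x y) (d u v) ⟩
            d u v ∎))
        where
        open ≡-Reasoning
        xu+yv : d x u + d y v ≡ d x y
        xu+yv = trans (cong₂ _+_ same (d-sym y v)) v∈I
        xv+yu : d x v + d y u ≡ d x y
        xv+yu = trans (cong₂ _+_ (sym same) (d-sym y u)) u∈I
      ... | no _    | _       | _        = z≤n
      ... | yes _   | no _    | _        = z≤n
      ... | yes _   | yes _   | no _     = z≤n

    hb2≤ : ∀ {t} → (∀ u v w x → d u v + d w x ≤ (d u w + d v x) ⊔ (d u x + d v w) + t) →
           hb2 d ≤ t
    hb2≤ {t} four-point = maxL-map-≤ _ (quads n) λ { (u , v , w , x) → gap-≤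
      (four-point u v w x)
      (subst (λ m → d u w + d v x ≤ (d u v + d w x) ⊔ (d u x + m) + t) (d-sym w v)
        (four-point u w v x))
      (subst₂ (λ m m' → d u x + d v w ≤ (d u v + m) ⊔ (d u w + m') + t) (d-sym x w) (d-sym x v)
        (four-point u x v w)) }

module ShortestPathMetric {n : ℕ} (G : Graph n) (d : Fin n → Fin n → ℕ) (isD : IsDistance G d) where

  _++ʷ_ : ∀ {u v w k m} → Walk G u v k → Walk G v w m → Walk G u w (k + m)
  here       ++ʷ q = q
  step uv p ++ʷ q = step uv (p ++ʷ q)

  reverseʷ : ∀ {u v k} → Walk G u v k → Walk G v u k
  reverseʷ here = here
  reverseʷ {k = suc k} (step uv p) =
    subst (Walk G _ _) (+-comm k 1) (reverseʷ p ++ʷ step (Graph.sym G uv) here)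

  splitAtʷ : ∀ {u v} k m → Walk G u v (k + m) → ∃ λ z → Walk G u z k × Walk G z v m
  splitAtʷ zero    m p           = _ , here , p
  splitAtʷ (suc k) m (step uv p) with splitAtʷ k m p
  ... | z , p₁ , p₂ = z , step uv p₁ , p₂

  geodesic : ∀ u v → Walk G u v (d u v)
  geodesic u v = proj₁ (isD u v)

  d-minimal : ∀ {u v k} → Walk G u v k → d u v ≤ k
  d-minimal {u} {v} = proj₂ (isD u v) _

  d-sym : ∀ u v → d u v ≡ d v u
  d-sym u v = ≤-antisym (d-minimal (reverseʷ (geodesic v u))) (d-minimal (reverseʷ (geodesic u v)))

  d-triangle : ∀ u v w → d u w ≤ d u v + d v w
  d-triangle u v w = d-minimal (geodesic u v ++ʷ geodesic v w)

  d-refl : ∀ u → d u u ≡ 0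
  d-refl u = n≤0⇒n≡0 (d-minimal here)

  Meet : Fin n × ℕ → Fin n × ℕ → Set
  Meet D D′ = ∃ λ z → InDisk d z D × InDisk d z D′

  meet : ∀ {c c′ r r′} → d c c′ ≤ r + r′ → Meet (c , r) (c′ , r′)
  meet {c} {c′} {r} {r′} cc′≤ with ≤-total (d c c′) r
  ... | inj₁ cc′≤r = c′ , cc′≤r , subst (_≤ r′) (sym (d-refl c′)) z≤n
  ... | inj₂ r≤cc′ with m≤n⇒∃[o]m+o≡n r≤cc′
  ... | q , r+q≡cc′ with splitAtʷ r q (subst (Walk G c c′) (sym r+q≡cc′) (geodesic c c′))
  ... | z , p₁ , p₂ = z , d-minimal p₁ , ≤-trans (≤-reflexive (d-sym c′ z))
        (≤-trans (d-minimal p₂) (+-cancelˡ-≤ r q r′ (subst (_≤ r + r′) (sym r+q≡cc′) cc′≤)))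

  meet-refl : ∀ D → Meet D D
  meet-refl (c , r) = c , c∈ , c∈
    where
    c∈ : d c c ≤ r
    c∈ = subst (_≤ r) (sym (d-refl c)) z≤n

  meet-swap : ∀ {D D′} → Meet D D′ → Meet D′ D
  meet-swap (z , z∈D , z∈D′) = z , z∈D′ , z∈D

  helly₃ : Helly d → ∀ {D₁ D₂ D₃} → Meet D₁ D₂ → Meet D₁ D₃ → Meet D₂ D₃ →
           ∃ λ z → InDisk d z D₁ × InDisk d z D₂ × InDisk d z D₃
  helly₃ helly {D₁} {D₂} {D₃} m₁₂ m₁₃ m₂₃ with helly (D₁ ∷ D₂ ∷ D₃ ∷ []) pairwise
    where
    pairwise : ∀ {D D′} → D ∈ D₁ ∷ D₂ ∷ D₃ ∷ [] → D′ ∈ D₁ ∷ D₂ ∷ D₃ ∷ [] → Meet D D′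
    pairwise (here refl)                (here refl)                = meet-refl D₁
    pairwise (here refl)                (there (here refl))        = m₁₂
    pairwise (here refl)                (there (there (here refl))) = m₁₃
    pairwise (there (here refl))        (here refl)                = meet-swap m₁₂
    pairwise (there (here refl))        (there (here refl))        = meet-refl D₂
    pairwise (there (here refl))        (there (there (here refl))) = m₂₃
    pairwise (there (there (here refl))) (here refl)                = meet-swap m₁₃
    pairwise (there (there (here refl))) (there (here refl))        = meet-swap m₂₃
    pairwise (there (there (here refl))) (there (there (here refl))) = meet-refl D₃
  ... | z , z∈ = z , z∈ (here refl) , z∈ (there (here refl)) , z∈ (there (there (here refl)))

  ∈-slice : ∀ {u v a i j} → d u v ≡ i + j → d u a ≤ i → d v a ≤ j →
            d u a + d a v ≡ d u v × d u a ≡ i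
  ∈-slice {u} {v} {a} {i} {j} uv≡ ua≤ va≤ = ua+av≡uv , ≤-antisym ua≤ i≤ua
    where
    ua+av≤i+j : d u a + d a v ≤ i + j
    ua+av≤i+j = +-mono-≤ ua≤ (subst (_≤ j) (d-sym v a) va≤)
    ua+av≡uv : d u a + d a v ≡ d u v
    ua+av≡uv = ≤-antisym (subst (d u a + d a v ≤_) (sym uv≡) ua+av≤i+j) (d-triangle u a v)
    i≤ua : i ≤ d u a
    i≤ua = +-cancelʳ-≤ j i (d u a) (begin
      i + j           ≡⟨ sym uv≡ ⟩
      d u v           ≡⟨ sym ua+av≡uv ⟩
      d u a + d a v   ≤⟨ +-monoʳ-≤ (d u a) (subst (_≤ j) (d-sym v a) va≤) ⟩
      d u a + j       ∎)
      where open ≤-Reasoning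

  module _ (helly : Helly d) where

    near-slice : ∀ {u v w i j r} → d u v ≡ i + j → d u w ≤ i + r → d v w ≤ j + r →
      ∃ λ a → (d u a + d a v ≡ d u v × d u a ≡ i) × d w a ≤ r
    near-slice uv≡ uw≤ vw≤ with helly₃ helly (meet (≤-reflexive uv≡)) (meet uw≤) (meet vw≤)
    ... | a , ua≤ , va≤ , wa≤ = a , ∈-slice uv≡ ua≤ va≤ , wa≤

    slice-bound : ∀ {u v w x} i j r s → d u v ≡ i + j →
      d u w ≤ i + r → d v w ≤ j + r → d u x ≤ i + s → d v x ≤ j + s →
      d w x ≤ r + tau d + s
    slice-bound {u} {v} {w} {x} i j r s uv≡ uw≤ vw≤ ux≤ vx≤
      with near-slice uv≡ uw≤ vw≤ | near-slice uv≡ ux≤ vx≤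
    ... | a , (a∈I , ua≡i) , wa≤ | b , (b∈I , ub≡i) , xb≤ = begin
      d w x                   ≤⟨ d-triangle w a x ⟩
      d w a + d a x           ≤⟨ +-monoʳ-≤ (d w a) (d-triangle a b x) ⟩
      d w a + (d a b + d b x) ≤⟨ +-mono-≤ wa≤ (+-mono-≤ ab≤τ (subst (_≤ s) (d-sym x b) xb≤)) ⟩
      r + (tau d + s)         ≡⟨ sym (+-assoc r (tau d) s) ⟩
      r + tau d + s           ∎
      where
      open ≤-Reasoning
      ab≤τ : d a b ≤ tau d
      ab≤τ = same-slice⇒≤tau d a∈I b∈I (trans ua≡i (sym ub≡i))

    slice-four-point : ∀ u v w x i e → e ≤ 1 →
      d u x + d u v ≤ 2 * i + d v x → 2 * i + d v w ≤ e + (d u w + d u v) →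
      d u v + d w x ≤ e + (d u w + d v x + tau d)
    slice-four-point u v w x i e e≤1 E₁ E₂ = begin
      d u v + d w x                 ≤⟨ +-monoʳ-≤ (d u v) wx≤ ⟩
      d u v + (r + tau d + s)       ≡⟨ rearrange (d u v) r (tau d) s ⟩
      d u v + (r + s) + tau d       ≡⟨ cong (_+ tau d) total ⟩
      e + (d u w + d v x) + tau d   ≡⟨ +-assoc e (d u w + d v x) (tau d) ⟩
      e + (d u w + d v x + tau d)   ∎
      where
      open ≤-Reasoning
      uv≤uw+vw : d u v ≤ d u w + d v w
      uv≤uw+vw = subst (λ m → d u v ≤ d u w + m) (d-sym w v) (d-triangle u w v)
      uv≤ux+vx : d u v ≤ d u x + d v x
      uv≤ux+vx = subst (λ m → d u v ≤ d u x + m) (d-sym x v) (d-triangle u x v)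
      open SliceRadii (slice-radii (d u v) (d u w) (d u x) (d v w) (d v x) i e e≤1
                         (d-triangle u v w) uv≤uw+vw uv≤ux+vx E₁ E₂)
      wx≤ : d w x ≤ r + tau d + s
      wx≤ = slice-bound i j r s uv≡i+j uw≤i+r vw≤j+r ux≤i+s vx≤j+s
      rearrange : ∀ a r t s → a + (r + t + s) ≡ a + (r + s) + t
      rearrange = solve-∀

    -- The slice through (u,v) would have to sit at the half-integer
    -- (d u x + d u v − d v x) / 2, and there is no room to round it.
    OddTight : Fin n → Fin n → Fin n → Fin n → Set
    OddTight u v w x = d u x + d v w ≡ d u w + d v x × ∃ λ i → suc (d u x + d u v) ≡ 2 * i + d v x

    four-point-or-odd : ∀ u v w x → d u x + d v w ≤ d u w + d v x →
      d u v + d w x ≤ d u w + d v x + tau d ⊎ OddTight u v w x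
    four-point-or-odd u v w x CB = by-parity (even-or-odd p)
      where
      p : ℕ
      p = d u x + d u v ∸ d v x
      vx+p≡ : d v x + p ≡ d u x + d u v
      vx+p≡ = m+[n∸m]≡n (subst (d v x ≤_)
        (trans (cong (_+ d u x) (d-sym v u)) (+-comm (d u v) (d u x))) (d-triangle v u x))
      E₁ : ∀ i → p ≤ 2 * i → d u x + d u v ≤ 2 * i + d v x
      E₁ i p≤2i = subst (_≤ 2 * i + d v x) (trans (+-comm p (d v x)) vx+p≡) (+-monoˡ-≤ (d v x) p≤2i)
      E₂ : ∀ k i → k + d u x + d v w ≤ d u w + d v x → 2 * i ≡ k + p → 2 * i + d v w ≤ d u w + d u v
      E₂ k i CBₖ 2i≡k+p = subst (λ m → m + d v w ≤ d u w + d u v) (sym 2i≡k+p)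
        (excess-≤ k p (d u x) (d u v) (d u w) (d v w) (d v x) vx+p≡ CBₖ)
      by-parity : (∃ λ i → 2 * i ≡ p ⊎ 2 * i ≡ suc p) →
                  d u v + d w x ≤ d u w + d v x + tau d ⊎ OddTight u v w x
      by-parity (i , inj₁ 2i≡p) =
        inj₁ (slice-four-point u v w x i 0 z≤n (E₁ i (≤-reflexive (sym 2i≡p))) (E₂ 0 i CB 2i≡p))
      by-parity (i , inj₂ 2i≡1+p) with m≤n⇒m<n∨m≡n CB
      ... | inj₁ CB< = inj₁ (slice-four-point u v w x i 0 z≤n
                         (E₁ i (subst (p ≤_) (sym 2i≡1+p) (n≤1+n p))) (E₂ 1 i CB< 2i≡1+p))
      ... | inj₂ CB≡ = inj₂ (CB≡ , i , trans (cong suc (trans (sym vx+p≡) (+-comm (d v x) p)))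
                                             (cong (_+ d v x) (sym 2i≡1+p)))

    -- If the slice argument fails both through (u,v) and through (w,x), then
    -- d u v + d w x and d u w + d v x have the same parity, and τ is even.
    four-point-≤ : 2 ∣ tau d → ∀ u v w x → d u x + d v w ≤ d u w + d v x →
      d u v + d w x ≤ d u w + d v x + tau d
    four-point-≤ (divides k τ≡k*2) u v w x CB
      with four-point-or-odd u v w x CB | four-point-or-odd w x u v CB′
      where
      CB′ : d w v + d x u ≤ d w u + d x v
      CB′ = subst₂ _≤_ (trans (+-comm (d u x) (d v w)) (cong₂ _+_ (d-sym v w) (d-sym u x)))
              (cong₂ _+_ (d-sym u w) (d-sym v x)) CB
    ... | inj₁ bound | _ = bound
    ... | inj₂ _ | inj₁ bound′ = subst₂ (λ m m′ → m ≤ m′ + tau d)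
          (+-comm (d w x) (d u v)) (cong₂ _+_ (d-sym w u) (d-sym x v)) bound′
    ... | inj₂ (balanced , i , odd) | inj₂ (_ , i′ , odd′) = ≤-pred (≤∧≢⇒< weak (λ tight →
          parity-clash i i′ k (d u x) (d u v) (d u w) (d v w) (d v x) (d w x) balanced odd odd″
            (trans tight (cong (λ m → suc (d u w + d v x + m)) (trans τ≡k*2 (*-comm k 2))))))
      where
      weak : d u v + d w x ≤ suc (d u w + d v x + tau d)
      weak = slice-four-point u v w x i 1 ≤-refl (≤-trans (n≤1+n _) (≤-reflexive odd))
               (≤-reflexive (odd-slice i (d u x) (d u v) (d u w) (d v w) (d v x) balanced odd))
      odd″ : suc (d v w + d w x) ≡ 2 * i′ + d v x
      odd″ = subst₂ (λ m m′ → suc (m + d w x) ≡ 2 * i′ + m′) (d-sym w v) (d-sym x v) odd′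

    four-point-⊔ : 2 ∣ tau d → ∀ u v w x →
      d u v + d w x ≤ (d u w + d v x) ⊔ (d u x + d v w) + tau d
    four-point-⊔ τ-even u v w x with ≤-total (d u x + d v w) (d u w + d v x)
    ... | inj₁ ux+vw≤ = ≤-trans (four-point-≤ τ-even u v w x ux+vw≤)
                          (+-monoˡ-≤ (tau d) (m≤m⊔n (d u w + d v x) (d u x + d v w)))
    ... | inj₂ uw+vx≤ = ≤-trans (subst (λ m → d u v + m ≤ d u x + d v w + tau d) (d-sym x w)
                                  (four-point-≤ τ-even u v x w uw+vx≤))
                          (+-monoˡ-≤ (tau d) (m≤n⊔m (d u w + d v x) (d u x + d v w)))

corollary1 : ∀ (n : ℕ) (G : Graph n) (d : Fin n → Fin n → ℕ) →
    Connected G → IsDistance G d → Helly d →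
    2 ∣ tau d →
    (2 ∣ hb2 d) × (hb2 d ≡ tau d)
corollary1 n G d _ isD helly τ-even = subst (2 ∣_) (sym hb2≡τ) τ-even , hb2≡τ
  where
  open ShortestPathMetric G d isD
  hb2≡τ : hb2 d ≡ tau d
  hb2≡τ = ≤-antisym (hb2≤ d d-sym (four-point-⊔ helly τ-even))
                    (tau≤hb2 d d-sym)
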